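{- Let $G$ be a finite graph with minimum degree $\delta(G)=2$ and average degree $\overline{d}(G)<\frac83$. Then $G$ has two adjacent vertices of degree $2$, or some connected component $S$ of the subgraph of $G$ induced by the vertices of degree $3$ is a tree such that every edge of $G$ with exactly one endpoint in $S$ has its other endpoint of degree $2$ in $G$.
   Context: Graphs are finite and simple; $\overline{d}(G)$ is the average vertex degree. -}

module Defs where

open import Data.Nat using (ℕ; _+_; _*_; _<_; _≤_)
open import Data.Bool using (Bool; true; false)
open import Data.Fin using (Fin)
open import Data.List using (List; []; _∷_; _++_; length; map; filter)
open import Data.Nat.ListAction using (sum)
open import Data.List.Relation.Unary.All using (All)
open import Data.List.Relation.Unary.Linked using (Linked)
open import Data.List.Relation.Unary.Unique.Propositional using (Unique)
open import Data.Fin.Base using ()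
open import Data.List using (allFin)
open import Data.Product using (Σ; ∃; ∃-syntax; _×_)
open import Relation.Binary.PropositionalEquality using (_≡_)
open import Relation.Nullary using (¬_)
open import Data.Bool using (T)

record Graph (n : ℕ) : Set where
  field
    adj   : Fin n → Fin n → Bool
    sym   : ∀ u v → adj u v ≡ adj v u
    irrefl : ∀ v → adj v v ≡ false
open Graph public

module _ {n : ℕ} (G : Graph n) where

  deg : Fin n → ℕ
  deg v = length (filter (λ u → T? (adj G v u)) (allFin n))
    where
    open import Data.Bool.Properties using () renaming (T? to T?)

  degSum : ℕ
  degSum = sum (map deg (allFin n))

  MinDegreeIs : ℕ → Set
  MinDegreeIs k = (∀ v → k ≤ deg v) × (∃[ v ] deg v ≡ k)

  -- average degree d̄(G) = degSum / n < 8/3, written over ℕ as 3·degSum < 8·n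
  AvgDegree<8/3 : Set
  AvgDegree<8/3 = 3 * degSum < 8 * n

  Subset : Set
  Subset = Fin n → Bool

  V3 : Subset
  V3 v with deg v Data.Nat.≟ 3
  ... | Relation.Nullary.yes _ = true
  ... | Relation.Nullary.no _ = false
    where import Data.Nat

  data WalkIn (S : Subset) : Fin n → Fin n → Set where
    here : ∀ {u} → S u ≡ true → WalkIn S u u
    step : ∀ {u v w} → S u ≡ true → adj G u v ≡ true → WalkIn S v w → WalkIn S u w

  ConnectedIn : Subset → Set
  ConnectedIn S = ∀ u v → S u ≡ true → S v ≡ true → WalkIn S u v

  Adj : Fin n → Fin n → Set
  Adj u v = adj G u v ≡ true

  CycleIn : Subset → Set
  CycleIn S = Σ (Fin n) λ v → Σ (List (Fin n)) λ vs →
      (2 ≤ length vs) × Unique (v ∷ vs) × All (λ x → S x ≡ true) (v ∷ vs)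
    × Linked Adj (v ∷ vs ++ v ∷ [])

  IsTreeIn : Subset → Set
  IsTreeIn S = (∃[ v ] S v ≡ true) × ConnectedIn S × ¬ CycleIn S

  IsComponentOf : Subset → Subset → Set
  IsComponentOf S T =
      (∃[ v ] S v ≡ true)
    × (∀ v → S v ≡ true → T v ≡ true)
    × ConnectedIn S
    × (∀ u v → S u ≡ true → T v ≡ true → adj G u v ≡ true → S v ≡ true)

-- Discharging. Give every vertex v the charge 3 d(v) − 8; the total is 3·Σd − 8n < 0.
-- A vertex of degree ≥ 4 sends 1 to each neighbour and a vertex of degree 3 sends 1 to each neighbour
-- of degree 2. If no two vertices of degree 2 are adjacent, every vertex of degree 2 ends with charge
-- 0, every vertex of degree d ≥ 4 with 2d − 8 ≥ 0, and the vertices of a component C of G[V₃] end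
-- with total 2(e(C) + e(C, V≥4) − |C|). So some C has e(C) + e(C, V≥4) < |C|. As C is connected,
-- e(C) ≥ |C| − 1, with equality only for a tree; hence C is a tree with no neighbour of degree ≥ 4,
-- and, C being a component of G[V₃], no outside neighbour of degree 3 either.
module Submission where

open import Defs hiding (sym)
open import Data.Nat using (ℕ)
open import Data.Bool using (true; false)
open import Data.Product using (Σ; _×_)
open import Data.Sum using (_⊎_)
open import Data.Fin using (Fin)
open import Relation.Binary.PropositionalEquality using (_≡_)

open import Data.Nat using (zero; suc; _+_; _*_; _≤_; z≤n; s≤s; _≟_; _≤?_)
open import Data.Nat.Properties
open import Data.Bool using (Bool; _∧_; _∨_; not)
import Data.Bool.Properties as Bool
open import Data.Fin using (zero; suc)
open import Data.Fin.Properties using (any?) renaming (_≟_ to _≟ᶠ_)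
open import Data.Product using (_,_; proj₁; proj₂; ∃-syntax)
open import Data.Sum using (inj₁; inj₂)
open import Data.Empty using (⊥; ⊥-elim)
open import Function using (_∘_)
open import Relation.Binary.PropositionalEquality
  using (refl; sym; trans; cong; cong₂; subst; subst₂; _≢_; _≗_; module ≡-Reasoning)
open import Relation.Nullary using (¬_; Dec; yes; no; does; ¬?; _×-dec_)
open import Relation.Nullary.Decidable using (dec-true; dec-false; decidable-stable)
open import Data.List using (List; []; _∷_; _++_; length; filter; map; tabulate)
import Data.Nat.ListAction as List
open import Data.List.Membership.Propositional using (_∈_; _∉_)
open import Data.List.Relation.Unary.Any using (here; there)
open import Data.List.Relation.Unary.All using (All) renaming (lookup to All-lookup)
open import Data.List.Relation.Unary.Linked using (Linked; [-]; _∷_)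
open import Data.List.Relation.Unary.Unique.Propositional using (Unique)
open import Data.List.Relation.Unary.Unique.Propositional.Properties using (Unique[x∷xs]⇒x∉xs)
open import Data.List.Relation.Unary.AllPairs using (_∷_)
open import Data.Nat.Tactic.RingSolver using (solve-∀)
open import Algebra.Properties.Semiring.Sum +-*-semiring
  using (sum; sum-cong-≗; ∑-distrib-+; ∑-comm; *-distribˡ-sum; sum-replicate-zero)

⟦_⟧ : Bool → ℕ
⟦ true ⟧ = 1
⟦ false ⟧ = 0

sum-mono-≤ : ∀ {m} {f g : Fin m → ℕ} → (∀ i → f i ≤ g i) → sum f ≤ sum g
sum-mono-≤ {zero} f≤g = z≤n
sum-mono-≤ {suc m} f≤g = +-mono-≤ (f≤g zero) (sum-mono-≤ (f≤g ∘ suc))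

≤-sum : ∀ {m} (f : Fin m → ℕ) i → f i ≤ sum f
≤-sum f zero = m≤m+n _ _
≤-sum f (suc i) = ≤-trans (≤-sum (f ∘ suc) i) (m≤n+m _ (f zero))

+-≤-sum : ∀ {m} (f : Fin m → ℕ) {i j} → i ≢ j → f i + f j ≤ sum f
+-≤-sum f {zero} {zero} i≢j = ⊥-elim (i≢j refl)
+-≤-sum f {zero} {suc j} _ = +-monoʳ-≤ (f zero) (≤-sum (f ∘ suc) j)
+-≤-sum f {suc i} {zero} _ = subst (_≤ sum f) (+-comm (f zero) _) (+-monoʳ-≤ (f zero) (≤-sum (f ∘ suc) i))
+-≤-sum f {suc i} {suc j} i≢j =
  ≤-trans (+-≤-sum (f ∘ suc) (i≢j ∘ cong suc)) (m≤n+m _ (f zero))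

sum-const : ∀ m c → sum {m} (λ _ → c) ≡ m * c
sum-const zero c = refl
sum-const (suc m) c = cong (c +_) (sum-const m c)

sum-+₃ : ∀ {m} (f g h : Fin m → ℕ) → sum (λ i → f i + (g i + h i)) ≡ sum f + (sum g + sum h)
sum-+₃ f g h = trans (∑-distrib-+ f (λ i → g i + h i)) (cong (sum f +_) (∑-distrib-+ g h))

sum-indicator : ∀ {m} (w : Fin m) (f : Fin m → ℕ) → sum (λ x → ⟦ does (x ≟ᶠ w) ⟧ * f x) ≡ f w
sum-indicator {suc m} zero f =
  trans (cong (f zero + 0 +_) (sum-replicate-zero m)) (trans (+-identityʳ _) (+-identityʳ (f zero)))
sum-indicator (suc w) f = sum-indicator w (f ∘ suc)

private variable m : ℕ

_⊆_ : (Fin m → Bool) → (Fin m → Bool) → Set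
R ⊆ S = ∀ x → R x ≡ true → S x ≡ true

∅ : Fin m → Bool
∅ _ = false

insert : Fin m → (Fin m → Bool) → Fin m → Bool
insert w R x = does (x ≟ᶠ w) ∨ R x

_∖_ : (Fin m → Bool) → (Fin m → Bool) → Fin m → Bool
(R ∖ S) x = R x ∧ not (S x)

insert-∋ : ∀ w (R : Fin m → Bool) → insert w R w ≡ true
insert-∋ w R = cong (_∨ R w) (dec-true (w ≟ᶠ w) refl)

insert-⊇ : ∀ w (R : Fin m → Bool) → R ⊆ insert w R
insert-⊇ w R x Rx rewrite Rx = Bool.∨-zeroʳ _

insert-⊆ : ∀ {w} {R S : Fin m → Bool} → R ⊆ S → S w ≡ true → insert w R ⊆ S
insert-⊆ {w = w} R⊆S Sw x x∈ with x ≟ᶠ w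
... | yes refl = Sw
... | no _ = R⊆S x x∈

sumOver : (Fin m → Bool) → (Fin m → ℕ) → ℕ
sumOver R f = sum (λ x → ⟦ R x ⟧ * f x)

card : (Fin m → Bool) → ℕ
card R = sumOver R (λ _ → 1)

module _ (R : Fin m → Bool) where

  sumOver-cong-on : ∀ {f g} → (∀ x → R x ≡ true → f x ≡ g x) → sumOver R f ≡ sumOver R g
  sumOver-cong-on {f} {g} f≡g = sum-cong-≗ pointwise
    where
    pointwise : ∀ x → ⟦ R x ⟧ * f x ≡ ⟦ R x ⟧ * g x
    pointwise x with R x in Rx
    ... | true = cong (1 *_) (f≡g x Rx)
    ... | false = refl

  sumOver-mono-on : ∀ {f g} → (∀ x → R x ≡ true → f x ≤ g x) → sumOver R f ≤ sumOver R g
  sumOver-mono-on {f} {g} f≤g = sum-mono-≤ pointwise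
    where
    pointwise : ∀ x → ⟦ R x ⟧ * f x ≤ ⟦ R x ⟧ * g x
    pointwise x with R x in Rx
    ... | true = *-monoʳ-≤ 1 (f≤g x Rx)
    ... | false = z≤n

  ≤-sumOver : ∀ f {x} → R x ≡ true → f x ≤ sumOver R f
  ≤-sumOver f {x} Rx = subst (_≤ sumOver R f) (one-term Rx) (≤-sum (λ y → ⟦ R y ⟧ * f y) x)
    where
    one-term : ∀ {z} → R z ≡ true → ⟦ R z ⟧ * f z ≡ f z
    one-term {z} Rz rewrite Rz = *-identityˡ (f z)

  +-≤-sumOver : ∀ f {x y} → x ≢ y → R x ≡ true → R y ≡ true → f x + f y ≤ sumOver R f
  +-≤-sumOver f {x} {y} x≢y Rx Ry = subst (_≤ sumOver R f) (cong₂ _+_ (weight Rx) (weight Ry))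
                                          (+-≤-sum (λ z → ⟦ R z ⟧ * f z) x≢y)
    where
    weight : ∀ {z} → R z ≡ true → ⟦ R z ⟧ * f z ≡ f z
    weight {z} Rz rewrite Rz = *-identityˡ (f z)

  sumOver-+ : ∀ f g → sumOver R (λ x → f x + g x) ≡ sumOver R f + sumOver R g
  sumOver-+ f g = trans (sum-cong-≗ (λ x → *-distribˡ-+ ⟦ R x ⟧ (f x) (g x)))
                        (∑-distrib-+ (λ x → ⟦ R x ⟧ * f x) (λ x → ⟦ R x ⟧ * g x))

  sumOver-* : ∀ c f → sumOver R (λ x → c * f x) ≡ c * sumOver R f
  sumOver-* c f =
    trans (sum-cong-≗ (λ x → commute ⟦ R x ⟧ c (f x))) (sym (*-distribˡ-sum c (λ x → ⟦ R x ⟧ * f x)))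
    where
    commute : ∀ r c y → r * (c * y) ≡ c * (r * y)
    commute = solve-∀

  sumOver-zero : sumOver R (λ _ → 0) ≡ 0
  sumOver-zero = trans (sum-cong-≗ (λ x → *-zeroʳ ⟦ R x ⟧)) (sum-replicate-zero m)

sumOver-cong : ∀ {R S : Fin m → Bool} f → R ≗ S → sumOver R f ≡ sumOver S f
sumOver-cong f R≗S = sum-cong-≗ (λ x → cong (λ b → ⟦ b ⟧ * f x) (R≗S x))

sumOver-mono-⊆ : ∀ {R S : Fin m → Bool} f → R ⊆ S → sumOver R f ≤ sumOver S f
sumOver-mono-⊆ {R = R} {S} f R⊆S = sum-mono-≤ pointwise
  where
  pointwise : ∀ x → ⟦ R x ⟧ * f x ≤ ⟦ S x ⟧ * f x
  pointwise x with R x in Rx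
  ... | true rewrite R⊆S x Rx = ≤-refl
  ... | false = z≤n

sumOver-empty : ∀ (R : Fin m → Bool) f → (∀ x → R x ≡ false) → sumOver R f ≡ 0
sumOver-empty {m = m} R f R≡∅ = trans (sumOver-cong f R≡∅) (sum-replicate-zero m)

sumOver-split : ∀ {R A B : Fin m → Bool} f → (∀ x → ⟦ R x ⟧ ≡ ⟦ A x ⟧ + ⟦ B x ⟧) →
                sumOver R f ≡ sumOver A f + sumOver B f
sumOver-split {R = R} {A} {B} f split =
  trans (sum-cong-≗ (λ x → trans (cong (_* f x) (split x)) (*-distribʳ-+ (f x) ⟦ A x ⟧ ⟦ B x ⟧)))
        (∑-distrib-+ (λ x → ⟦ A x ⟧ * f x) (λ x → ⟦ B x ⟧ * f x))

sumOver-insert : ∀ {w} (R : Fin m → Bool) f → R w ≡ false → sumOver (insert w R) f ≡ f w + sumOver R f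
sumOver-insert {w = w} R f Rw =
  trans (sumOver-split {A = λ x → does (x ≟ᶠ w)} f split) (cong (_+ sumOver R f) (sum-indicator w f))
  where
  split : ∀ x → ⟦ insert w R x ⟧ ≡ ⟦ does (x ≟ᶠ w) ⟧ + ⟦ R x ⟧
  split x with x ≟ᶠ w
  ... | yes refl rewrite Rw = refl
  ... | no _ = refl

∖⁻ : ∀ (R S : Fin m → Bool) x → (R ∖ S) x ≡ true → R x ≡ true × S x ≡ false
∖⁻ R S x x∈ with R x | S x
... | true | false = refl , refl

∖⁺ : ∀ (R S : Fin m → Bool) x → R x ≡ true → S x ≡ false → (R ∖ S) x ≡ true
∖⁺ R S x Rx Sx rewrite Rx | Sx = refl

sumOver-∖ : ∀ {R C : Fin m → Bool} f → C ⊆ R → sumOver R f ≡ sumOver C f + sumOver (R ∖ C) f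
sumOver-∖ {R = R} {C} f C⊆R = sumOver-split {A = C} {B = R ∖ C} f split
  where
  split : ∀ x → ⟦ R x ⟧ ≡ ⟦ C x ⟧ + ⟦ (R ∖ C) x ⟧
  split x with R x in Rx | C x in Cx
  ... | true | true = refl
  ... | true | false = refl
  ... | false | false = refl
  ... | false | true with () ← trans (sym (C⊆R x Cx)) Rx

card≤ : (R : Fin m → Bool) → card R ≤ m
card≤ {m = m} R =
  ≤-trans (sum-mono-≤ (λ x → bound (R x))) (≤-reflexive (trans (sum-const m 1) (*-identityʳ m)))
  where
  bound : ∀ b → ⟦ b ⟧ * 1 ≤ 1
  bound true = ≤-refl
  bound false = z≤n

card-insert : ∀ {w} (R : Fin m → Bool) → R w ≡ false → card (insert w R) ≡ suc (card R)
card-insert R = sumOver-insert R (λ _ → 1)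

card-singleton : ∀ (w : Fin m) → card (insert w ∅) ≡ 1
card-singleton {m = m} w =
  trans (card-insert (∅ {m}) refl) (cong suc (sumOver-empty (∅ {m}) (λ _ → 1) (λ _ → refl)))

⊂⇒card< : ∀ {R S : Fin m → Bool} {x} → R ⊆ S → S x ≡ true → R x ≡ false →
          suc (card R) ≤ card S
⊂⇒card< {R = R} {S} R⊆S Sx Rx =
  subst (_≤ card S) (card-insert R Rx) (sumOver-mono-⊆ (λ _ → 1) (insert-⊆ R⊆S Sx))

⊆-dichotomy : ∀ {R S : Fin m → Bool} → R ⊆ S → R ≗ S ⊎ ∃[ x ] (S x ≡ true × R x ≡ false)
⊆-dichotomy {R = R} {S} R⊆S with any? (λ x → S x Bool.≟ true ×-dec R x Bool.≟ false)
... | yes witness = inj₂ witness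
... | no none = inj₁ equal
  where
  equal : R ≗ S
  equal x with R x in Rx | S x in Sx
  ... | true | true = refl
  ... | false | false = refl
  ... | true | false = sym (trans (sym Sx) (R⊆S x Rx))
  ... | false | true = ⊥-elim (none (x , Sx , Rx))

insert⁻ : ∀ {w} {R : Fin m → Bool} x → insert w R x ≡ true → x ≡ w ⊎ R x ≡ true
insert⁻ {w = w} x x∈ with x ≟ᶠ w
... | yes x≡w = inj₁ x≡w
... | no _ = inj₂ x∈

fromList : List (Fin m) → Fin m → Bool
fromList [] = ∅
fromList (y ∷ ys) = insert y (fromList ys)

fromList-∈ : ∀ {x} {xs : List (Fin m)} → x ∈ xs → fromList xs x ≡ true
fromList-∈ {x = x} {y ∷ ys} (here refl) = insert-∋ x (fromList ys)
fromList-∈ {x = x} {y ∷ ys} (there x∈ys) = insert-⊇ y (fromList ys) x (fromList-∈ x∈ys)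

fromList⁻ : ∀ {x} (xs : List (Fin m)) → fromList xs x ≡ true → x ∈ xs
fromList⁻ {x = x} (y ∷ ys) x∈ with insert⁻ {R = fromList ys} x x∈
... | inj₁ refl = here refl
... | inj₂ x∈ys = there (fromList⁻ ys x∈ys)

fromList-∉ : ∀ {x} {xs : List (Fin m)} → x ∉ xs → fromList xs x ≡ false
fromList-∉ {x = x} {xs} x∉xs = Bool.¬-not (x∉xs ∘ fromList⁻ xs)

fromList-⊆ : ∀ {S : Fin m → Bool} {xs} → All (λ x → S x ≡ true) xs → fromList xs ⊆ S
fromList-⊆ {xs = xs} all x x∈ = All-lookup all (fromList⁻ xs x∈)

module _ {a} {A : Set a} where

  lastOf : A → List A → A
  lastOf y [] = y
  lastOf y (z ∷ zs) = lastOf z zs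

  lastOf-∈ : ∀ y ys → lastOf y ys ∈ y ∷ ys
  lastOf-∈ y [] = here refl
  lastOf-∈ y (z ∷ zs) = there (lastOf-∈ z zs)

  Linked-∷ʳ⁻ : ∀ {r} {R : A → A → Set r} {v} y ys → Linked R (y ∷ ys ++ v ∷ []) →
               Linked R (y ∷ ys) × R (lastOf y ys) v
  Linked-∷ʳ⁻ y [] (y~v ∷ [-]) = [-] , y~v
  Linked-∷ʳ⁻ y (z ∷ zs) (y~z ∷ linked) with Linked-∷ʳ⁻ z zs linked
  ... | linked′ , last~v = y~z ∷ linked′ , last~v

length-filter-tabulate : ∀ {k} {a} {A : Set a} (p : A → Bool) (f : Fin k → A) →
                         length (filter (λ x → Bool.T? (p x)) (tabulate f)) ≡ card (p ∘ f)
length-filter-tabulate {zero} p f = refl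
length-filter-tabulate {suc k} p f with p (f zero)
... | true = cong suc (length-filter-tabulate p (f ∘ suc))
... | false = length-filter-tabulate p (f ∘ suc)

sum-map-tabulate : ∀ {k} {a} {A : Set a} (h : A → ℕ) (f : Fin k → A) →
                   List.sum (map h (tabulate f)) ≡ sum (h ∘ f)
sum-map-tabulate {zero} h f = refl
sum-map-tabulate {suc k} h f = cong (h (f zero) +_) (sum-map-tabulate h (f ∘ suc))

is≥4 : ℕ → Bool
is≥4 (suc (suc (suc (suc _)))) = true
is≥4 _ = false

is3 : ℕ → Bool
is3 d = does (d ≟ 3)

-- The charge sent along an edge from a vertex of degree d to a neighbour of degree d′.
send : ℕ → ℕ → ℕ
send 3 2 = 1
send (suc (suc (suc (suc _)))) _ = 1
send _ _ = 0

send-from-3 : ∀ d → send 3 d + ⟦ is3 d ⟧ + ⟦ is≥4 d ⟧ ≤ 1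
send-from-3 0 = z≤n
send-from-3 1 = z≤n
send-from-3 2 = ≤-refl
send-from-3 3 = ≤-refl
send-from-3 (suc (suc (suc (suc _)))) = ≤-refl

send-to-3 : ∀ d → send d 3 ≡ ⟦ is≥4 d ⟧
send-to-3 0 = refl
send-to-3 1 = refl
send-to-3 2 = refl
send-to-3 3 = refl
send-to-3 (suc (suc (suc (suc _)))) = refl

is3-≥4 : ∀ {d} → 4 ≤ d → is3 d ≡ false
is3-≥4 (s≤s (s≤s (s≤s (s≤s _)))) = refl

send-≥4 : ∀ {d d′} → 4 ≤ d → send d d′ ≡ 1
send-≥4 (s≤s (s≤s (s≤s (s≤s _)))) = refl

is≥4-≥4 : ∀ {d} → 4 ≤ d → is≥4 d ≡ true
is≥4-≥4 (s≤s (s≤s (s≤s (s≤s _)))) = refl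

send-to-2 : ∀ {d} → 3 ≤ d → send d 2 ≡ 1
send-to-2 {1} (s≤s ())
send-to-2 {2} (s≤s (s≤s ()))
send-to-2 {3} _ = refl
send-to-2 {suc (suc (suc (suc _)))} _ = refl

degree-cases : ∀ {d} → 2 ≤ d → d ≡ 2 ⊎ d ≡ 3 ⊎ 4 ≤ d
degree-cases {1} (s≤s ())
degree-cases {2} _ = inj₁ refl
degree-cases {3} _ = inj₂ (inj₁ refl)
degree-cases {suc (suc (suc (suc _)))} _ = inj₂ (inj₂ (s≤s (s≤s (s≤s (s≤s z≤n)))))

module _ {n : ℕ} (G : Graph n) where

  A : Fin n → Fin n → ℕ
  A v u = ⟦ adj G v u ⟧

  degIn : Subset G → Fin n → ℕ
  degIn R v = sumOver R (A v)

  degSumIn : Subset G → ℕ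
  degSumIn R = sumOver R (degIn R)

  deg≡card : ∀ v → deg G v ≡ card (adj G v)
  deg≡card v = length-filter-tabulate (adj G v) (λ u → u)

  degSum≡sum : degSum G ≡ sum (deg G)
  degSum≡sum = sum-map-tabulate (deg G) (λ u → u)

  degIn≡sumOver-adj : ∀ R v → degIn R v ≡ sumOver (adj G v) (λ u → ⟦ R u ⟧)
  degIn≡sumOver-adj R v = sum-cong-≗ (λ u → *-comm ⟦ R u ⟧ (A v u))

  1≤degIn : ∀ R {u v} → R u ≡ true → adj G v u ≡ true → 1 ≤ degIn R v
  1≤degIn R {u} {v} Ru v~u = subst (_≤ degIn R v) (cong ⟦_⟧ v~u) (≤-sumOver R (A v) Ru)

  2≤degIn : ∀ R {u u′ v} → u ≢ u′ → R u ≡ true → R u′ ≡ true →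
            adj G v u ≡ true → adj G v u′ ≡ true → 2 ≤ degIn R v
  2≤degIn R {u} {u′} {v} u≢u′ Ru Ru′ v~u v~u′ =
    subst (_≤ degIn R v) (cong₂ (λ b c → ⟦ b ⟧ + ⟦ c ⟧) v~u v~u′)
          (+-≤-sumOver R (A v) u≢u′ Ru Ru′)

  degSumIn-cong : ∀ {R S} → R ≗ S → degSumIn R ≡ degSumIn S
  degSumIn-cong {R} {S} R≗S =
    trans (sumOver-cong (degIn R) R≗S) (sumOver-cong-on S (λ x _ → sumOver-cong (A x) R≗S))

  degSumIn-insert : ∀ {w R} → R w ≡ false → degSumIn (insert w R) ≡ 2 * degIn R w + degSumIn R
  degSumIn-insert {w} {R} Rw = begin
      sumOver (insert w R) (degIn (insert w R))
    ≡⟨ sumOver-insert R (degIn (insert w R)) Rw ⟩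
      degIn (insert w R) w + sumOver R (degIn (insert w R))
    ≡⟨ cong₂ _+_ (degIn-insert w) (sumOver-cong-on R (λ x _ → degIn-insert x)) ⟩
      (A w w + degIn R w) + sumOver R (λ x → A x w + degIn R x)
    ≡⟨ cong₂ (λ a b → a + degIn R w + b) (cong ⟦_⟧ (irrefl G w))
             (sumOver-+ R (λ x → A x w) (degIn R)) ⟩
      degIn R w + (sumOver R (λ x → A x w) + degSumIn R)
    ≡⟨ cong (λ d → degIn R w + (d + degSumIn R))
            (sumOver-cong-on R (λ x _ → cong ⟦_⟧ (Graph.sym G x w))) ⟩
      degIn R w + (degIn R w + degSumIn R)
    ≡⟨ double (degIn R w) (degSumIn R) ⟩
      2 * degIn R w + degSumIn R
    ∎
    where
    open ≡-Reasoning
    double : ∀ d s → d + (d + s) ≡ 2 * d + s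
    double = solve-∀
    degIn-insert : ∀ x → degIn (insert w R) x ≡ A x w + degIn R x
    degIn-insert x = sumOver-insert R (A x) Rw

  -- 2|R| − 2e(G[R]) ≤ k, where e(G[R]) is the number of edges inside R.
  Excess≤ : ℕ → Subset G → Set
  Excess≤ k R = 2 * card R ≤ degSumIn R + k

  Excess≤-singleton : ∀ v → Excess≤ 2 (insert v ∅)
  Excess≤-singleton v =
    subst (λ c → 2 * c ≤ degSumIn (insert v ∅) + 2) (sym (card-singleton v)) (m≤n+m 2 _)

  Excess≤-cong : ∀ {k R S} → R ≗ S → Excess≤ k R → Excess≤ k S
  Excess≤-cong {k} R≗S =
    subst₂ (λ c d → 2 * c ≤ d + k) (sumOver-cong (λ _ → 1) R≗S) (degSumIn-cong R≗S)

  Excess≤-insert : ∀ {k k′ w} R → R w ≡ false → 2 + k ≤ k′ + 2 * degIn R w →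
                   Excess≤ k R → Excess≤ k′ (insert w R)
  Excess≤-insert {k} {k′} {w} R Rw budget excess = begin
      2 * card (insert w R)              ≡⟨ cong (2 *_) (card-insert R Rw) ⟩
      2 * suc (card R)                   ≡⟨ *-suc 2 (card R) ⟩
      2 + 2 * card R                     ≤⟨ +-monoʳ-≤ 2 excess ⟩
      2 + (degSumIn R + k)               ≡⟨ move (degSumIn R) k ⟩
      degSumIn R + (2 + k)               ≤⟨ +-monoʳ-≤ (degSumIn R) budget ⟩
      degSumIn R + (k′ + 2 * degIn R w)  ≡⟨ regroup (degSumIn R) k′ (degIn R w) ⟩
      (2 * degIn R w + degSumIn R) + k′  ≡⟨ cong (_+ k′) (sym (degSumIn-insert Rw)) ⟩
      degSumIn (insert w R) + k′         ∎
    where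
    open ≤-Reasoning
    move : ∀ s k → 2 + (s + k) ≡ s + (2 + k)
    move = solve-∀
    regroup : ∀ s k d → s + (k + 2 * d) ≡ 2 * d + s + k
    regroup = solve-∀

  Excess≤-insert-neighbour : ∀ {k w} R → R w ≡ false → 1 ≤ degIn R w →
                             Excess≤ k R → Excess≤ k (insert w R)
  Excess≤-insert-neighbour {k} {w} R Rw w~R =
    Excess≤-insert R Rw (subst (_≤ k + 2 * degIn R w) (+-comm k 2) (+-monoʳ-≤ k (*-monoʳ-≤ 2 w~R)))

  walk-start : ∀ {S u v} → WalkIn G S u v → S u ≡ true
  walk-start (here Su) = Su
  walk-start (step Su _ _) = Su

  walk-++ : ∀ {S u v w} → WalkIn G S u v → WalkIn G S v w → WalkIn G S u w
  walk-++ (here _) q = q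
  walk-++ (step Su u~v p) q = step Su u~v (walk-++ p q)

  walk-reverse : ∀ {S u v} → WalkIn G S u v → WalkIn G S v u
  walk-reverse (here Su) = here Su
  walk-reverse {u = u} (step {v = v} Su u~v p) =
    walk-++ (walk-reverse p) (step (walk-start p) (trans (Graph.sym G v u) u~v) (here Su))

  walk-mono : ∀ {S T} → S ⊆ T → ∀ {u v} → WalkIn G S u v → WalkIn G T u v
  walk-mono S⊆T (here Su) = here (S⊆T _ Su)
  walk-mono S⊆T (step Su u~v p) = step (S⊆T _ Su) u~v (walk-mono S⊆T p)

  walk-exit : ∀ {S u x} (R : Subset G) → WalkIn G S u x → R u ≡ true → R x ≡ false →
              ∃[ r ] ∃[ w ] (R r ≡ true × R w ≡ false × S w ≡ true × adj G r w ≡ true)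
  walk-exit R (here _) Ru Rx with () ← trans (sym Ru) Rx
  walk-exit {u = u} R (step {v = v} _ u~v p) Ru Rx with R v in Rv
  ... | true = walk-exit R p Rv Rx
  ... | false = u , v , Ru , Rv , walk-start p , u~v

  -- Grow R inside S along an edge leaving R (walk-exit): the new vertex has a neighbour in R,
  -- so the excess does not increase.
  connected⇒Excess≤ : ∀ {S} R {r k} → ConnectedIn G S → R ⊆ S → R r ≡ true →
                      Excess≤ k R → Excess≤ k S
  connected⇒Excess≤ {S} R₀ {r} {k} S-conn =
    extend n (≤-trans (card≤ S) (m≤m+n n (card R₀)))
    where
    extend : ∀ f {R} → card S ≤ f + card R → R ⊆ S → R r ≡ true → Excess≤ k R → Excess≤ k S
    extend f {R} bound R⊆S Rr excess with ⊆-dichotomy R⊆S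
    ... | inj₁ R≗S = Excess≤-cong R≗S excess
    extend zero {R} bound R⊆S Rr excess | inj₂ (x , Sx , Rx) =
      ⊥-elim (<-irrefl refl (≤-trans (⊂⇒card< R⊆S Sx Rx) bound))
    extend (suc f) {R} bound R⊆S Rr excess | inj₂ (x , Sx , Rx)
      with walk-exit R (S-conn r x (R⊆S r Rr) Sx) Rr Rx
    ... | r′ , w , Rr′ , Rw , Sw , r′~w =
      extend f (subst (card S ≤_) (sym (trans (cong (f +_) (card-insert R Rw)) (+-suc f (card R)))) bound)
             (insert-⊆ R⊆S Sw) (insert-⊇ w R r Rr)
             (Excess≤-insert-neighbour R Rw (1≤degIn R Rr′ (trans (Graph.sym G w r′) r′~w)) excess)

  connected⇒Excess≤2 : ∀ {S v} → ConnectedIn G S → S v ≡ true → Excess≤ 2 S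
  connected⇒Excess≤2 {S} {v} S-conn Sv =
    connected⇒Excess≤ (insert v ∅) {r = v} S-conn (insert-⊆ (λ _ ()) Sv) (insert-∋ v ∅)
                      (Excess≤-singleton v)

  path⇒Excess≤2 : ∀ {y ys} → Linked (Adj G) (y ∷ ys) → Unique (y ∷ ys) →
                  Excess≤ 2 (fromList (y ∷ ys))
  path⇒Excess≤2 {y} {[]} _ _ = Excess≤-singleton y
  path⇒Excess≤2 {y} {z ∷ zs} (y~z ∷ linked) unique@(_ ∷ unique′) =
    Excess≤-insert-neighbour (fromList (z ∷ zs)) (fromList-∉ (Unique[x∷xs]⇒x∉xs unique))
                             (1≤degIn (fromList (z ∷ zs)) (fromList-∈ {xs = z ∷ zs} (here refl)) y~z)
                             (path⇒Excess≤2 linked unique′)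

  connected∧cycle⇒Excess≤0 : ∀ {S} → ConnectedIn G S → CycleIn G S → Excess≤ 0 S
  connected∧cycle⇒Excess≤0 S-conn (v , [] , () , _)
  connected∧cycle⇒Excess≤0 S-conn (v , _ ∷ [] , s≤s () , _)
  connected∧cycle⇒Excess≤0 S-conn (v , y ∷ z ∷ zs , _ , unique@(_ ∷ path-unique) , inS , v~y ∷ linked)
    with Linked-∷ʳ⁻ y (z ∷ zs) linked
  ... | path-linked , last~v =
    connected⇒Excess≤ (fromList (v ∷ path)) {r = v} S-conn
                      (fromList-⊆ inS) (fromList-∈ {xs = v ∷ path} (here refl))
      (Excess≤-insert P (fromList-∉ {xs = path} (Unique[x∷xs]⇒x∉xs unique))
                        (*-monoʳ-≤ 2 two-neighbours)
                        (path⇒Excess≤2 path-linked path-unique))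
    where
    path = y ∷ z ∷ zs
    P = fromList path
    last = lastOf z zs
    y≢last : y ≢ last
    y≢last y≡last = Unique[x∷xs]⇒x∉xs path-unique (subst (_∈ z ∷ zs) (sym y≡last) (lastOf-∈ z zs))
    two-neighbours : 2 ≤ degIn P v
    two-neighbours = 2≤degIn P y≢last (fromList-∈ {xs = path} (here refl))
                             (fromList-∈ {xs = path} (there (lastOf-∈ z zs)))
                             v~y (trans (Graph.sym G v last) last~v)

  ClosedIn : Subset G → Subset G → Set
  ClosedIn T R = ∀ u w → R u ≡ true → T w ≡ true → adj G u w ≡ true → R w ≡ true

  grow : Subset G → Subset G → Subset G
  grow T C x = C x ∨ (T x ∧ does (any? (λ u → C u Bool.≟ true ×-dec adj G u x Bool.≟ true)))

  grow-⊇ : ∀ T C → C ⊆ grow T C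
  grow-⊇ T C x Cx rewrite Cx = refl

  grow-∋ : ∀ T C {u x} → T x ≡ true → C u ≡ true → adj G u x ≡ true → grow T C x ≡ true
  grow-∋ T C {u} {x} Tx Cu u~x
    rewrite Tx | dec-true (any? (λ u → C u Bool.≟ true ×-dec adj G u x Bool.≟ true)) (u , Cu , u~x) =
    Bool.∨-zeroʳ (C x)

  grow⁻ : ∀ T C x → grow T C x ≡ true →
          C x ≡ true ⊎ (T x ≡ true × ∃[ u ] (C u ≡ true × adj G u x ≡ true))
  grow⁻ T C x x∈ with C x | T x in Tx | any? (λ u → C u Bool.≟ true ×-dec adj G u x Bool.≟ true)
  ... | true  | _     | _ = inj₁ refl
  ... | false | true  | yes neighbour = inj₂ (refl , neighbour)
  ... | false | true  | no _ with () ← x∈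
  ... | false | false | _ with () ← x∈

  grow-mono : ∀ T {C D} → C ⊆ D → grow T C ⊆ grow T D
  grow-mono T {C} {D} C⊆D x x∈ with grow⁻ T C x x∈
  ... | inj₁ Cx = grow-⊇ T D x (C⊆D x Cx)
  ... | inj₂ (Tx , u , Cu , u~x) = grow-∋ T D Tx (C⊆D u Cu) u~x

  ball : Subset G → Fin n → ℕ → Subset G
  ball T v zero = insert v ∅
  ball T v (suc k) = grow T (ball T v k)

  component : Subset G → Fin n → Subset G
  component T v = ball T v n

  module _ (T : Subset G) (v : Fin n) where

    ball-∋ : ∀ k → ball T v k v ≡ true
    ball-∋ zero = insert-∋ v ∅
    ball-∋ (suc k) = grow-⊇ T (ball T v k) v (ball-∋ k)

    ball-⊆ : T v ≡ true → ∀ k → ball T v k ⊆ T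
    ball-⊆ Tv zero = insert-⊆ (λ _ ()) Tv
    ball-⊆ Tv (suc k) x x∈ with grow⁻ T (ball T v k) x x∈
    ... | inj₁ x∈ball = ball-⊆ Tv k x x∈ball
    ... | inj₂ (Tx , _) = Tx

    ball-⊆-closed : ∀ {R} → R v ≡ true → ClosedIn T R → ∀ k → ball T v k ⊆ R
    ball-⊆-closed Rv R-closed zero = insert-⊆ (λ _ ()) Rv
    ball-⊆-closed Rv R-closed (suc k) x x∈ with grow⁻ T (ball T v k) x x∈
    ... | inj₁ x∈ball = ball-⊆-closed Rv R-closed k x x∈ball
    ... | inj₂ (Tx , u , u∈ball , u~x) = R-closed u x (ball-⊆-closed Rv R-closed k u u∈ball) Tx u~x

    ball-walk : ∀ k x → ball T v k x ≡ true → WalkIn G (ball T v k) v x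
    ball-walk zero x x∈ with insert⁻ {R = ∅} x x∈
    ... | inj₁ refl = here x∈
    ball-walk (suc k) x x∈ with grow⁻ T (ball T v k) x x∈
    ... | inj₁ x∈ball = walk-mono (grow-⊇ T _) (ball-walk k x x∈ball)
    ... | inj₂ (_ , u , u∈ball , u~x) =
      walk-++ (walk-mono (grow-⊇ T _) (ball-walk k u u∈ball)) (step (grow-⊇ T _ u u∈ball) u~x (here x∈))

    component-stable : grow T (component T v) ⊆ component T v
    component-stable with stable-or-large n
      where
      stable-or-large : ∀ k → grow T (ball T v k) ⊆ ball T v k ⊎ suc k ≤ card (ball T v k)
      stable-or-large zero =
        inj₂ (≤-reflexive (sym (card-singleton v)))
      stable-or-large (suc k) with stable-or-large k
      ... | inj₁ stable = inj₁ (grow-mono T stable)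
      ... | inj₂ large with ⊆-dichotomy (grow-⊇ T (ball T v k))
      ...   | inj₁ same = inj₁ (grow-mono T (λ x x∈ → trans (same x) x∈))
      ...   | inj₂ (x , x∈ , x∉) = inj₂ (≤-trans (s≤s large) (⊂⇒card< (grow-⊇ T _) x∈ x∉))
    ... | inj₁ stable = stable
    ... | inj₂ large = ⊥-elim (<-irrefl refl (≤-trans large (card≤ (component T v))))

    component-∋ : component T v v ≡ true
    component-∋ = ball-∋ n

    component-connected : ConnectedIn G (component T v)
    component-connected x y x∈ y∈ = walk-++ (walk-reverse (ball-walk n x x∈)) (ball-walk n y y∈)

    component-closed : ClosedIn T (component T v)
    component-closed u w u∈ Tw u~w = component-stable w (grow-∋ T _ Tw u∈ u~w)

    component-isComponent : T v ≡ true → IsComponentOf G (component T v) T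
    component-isComponent Tv = (v , component-∋) , ball-⊆ Tv n , component-connected , component-closed

  sumOver-≤-componentwise : ∀ T (g f : Fin n → ℕ) →
    (∀ v → T v ≡ true → sumOver (component T v) g ≤ sumOver (component T v) f) →
    sumOver T g ≤ sumOver T f
  sumOver-≤-componentwise T g f per-component = peel n T (card≤ T) (λ _ Tx → Tx) (λ _ _ _ Tw _ → Tw)
    where
    peel : ∀ k R → card R ≤ k → R ⊆ T → ClosedIn T R → sumOver R g ≤ sumOver R f
    peel k R bound R⊆T R-closed with any? (λ v → R v Bool.≟ true)
    ... | no empty =
      subst (_≤ sumOver R f) (sym (sumOver-empty R g (λ x → Bool.¬-not (empty ∘ (x ,_))))) z≤n
    peel zero R bound R⊆T R-closed | yes (v , Rv) =
      ⊥-elim (<-irrefl refl (≤-trans (≤-sumOver R (λ _ → 1) Rv) bound))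
    peel (suc k) R bound R⊆T R-closed | yes (v , Rv) = begin
        sumOver R g                      ≡⟨ sumOver-∖ g C⊆R ⟩
        sumOver C g + sumOver (R ∖ C) g  ≤⟨ +-mono-≤ (per-component v (R⊆T v Rv)) rest ⟩
        sumOver C f + sumOver (R ∖ C) f  ≡⟨ sym (sumOver-∖ f C⊆R) ⟩
        sumOver R f                      ∎
      where
      open ≤-Reasoning
      C = component T v
      C⊆R : C ⊆ R
      C⊆R = ball-⊆-closed T v Rv R-closed n
      rest-bound : card (R ∖ C) ≤ k
      rest-bound = +-cancelˡ-≤ 1 _ _
        (≤-trans (+-monoˡ-≤ (card (R ∖ C)) (≤-sumOver C (λ _ → 1) (component-∋ T v)))
                 (subst (_≤ suc k) (sumOver-∖ (λ _ → 1) C⊆R) bound))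
      rest-⊆ : (R ∖ C) ⊆ T
      rest-⊆ x x∈ = R⊆T x (proj₁ (∖⁻ R C x x∈))
      rest-closed : ClosedIn T (R ∖ C)
      rest-closed u w u∈ Tw u~w = ∖⁺ R C w (R-closed u w Ru Tw u~w) (Bool.¬-not w∉C)
        where
        Ru = proj₁ (∖⁻ R C u u∈)
        w∉C : C w ≢ true
        w∉C Cw with () ← trans (sym (proj₂ (∖⁻ R C u u∈)))
                               (component-closed T v w u Cw (R⊆T u Ru) (trans (Graph.sym G w u) u~w))
      rest : sumOver (R ∖ C) g ≤ sumOver (R ∖ C) f
      rest = peel k (R ∖ C) rest-bound rest-⊆ rest-closed

  V≥4 : Subset G
  V≥4 u = is≥4 (deg G u)

  V3≡is3 : ∀ v → V3 G v ≡ is3 (deg G v)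
  V3≡is3 v with deg G v ≟ 3
  ... | yes d≡3 = sym (dec-true (deg G v ≟ 3) d≡3)
  ... | no d≢3 = sym (dec-false (deg G v ≟ 3) d≢3)

  weight : Fin n → ℕ
  weight v = degIn (V3 G) v + 2 * degIn V≥4 v

  -- For a component C of G[V₃], Σ_C weight = 2e(C) + 2e(C, V≥4) (degIn-closed),
  -- so EdgeRich C says |C| ≤ e(C) + e(C, V≥4).
  EdgeRich : Subset G → Set
  EdgeRich R = sumOver R (λ _ → 2) ≤ sumOver R weight

  EdgeRich? : ∀ R → Dec (EdgeRich R)
  EdgeRich? R = _ ≤? _

  outflow inflow : Fin n → ℕ
  outflow v = sumOver (adj G v) (λ u → send (deg G v) (deg G u))
  inflow v = sumOver (adj G v) (λ u → send (deg G u) (deg G v))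

  sum-outflow≡sum-inflow : sum outflow ≡ sum inflow
  sum-outflow≡sum-inflow = trans (∑-comm (λ v u → A v u * send (deg G v) (deg G u)))
    (sum-cong-≗ λ u → sum-cong-≗ λ v →
       cong (λ b → ⟦ b ⟧ * send (deg G v) (deg G u)) (Graph.sym G v u))

  NoAdjacentDeg2 : Set
  NoAdjacentDeg2 = ∀ u v → adj G u v ≡ true → deg G u ≡ 2 → deg G v ≡ 2 → ⊥

  MinDeg≥2 : Set
  MinDeg≥2 = ∀ v → 2 ≤ deg G v

  outflow-2 : ∀ {v} → deg G v ≡ 2 → outflow v ≡ 0
  outflow-2 {v} dv =
    trans (sumOver-cong-on (adj G v) (λ u _ → cong (λ d → send d (deg G u)) dv)) (sumOver-zero (adj G v))

  inflow-2 : MinDeg≥2 → NoAdjacentDeg2 → ∀ {v} → deg G v ≡ 2 → inflow v ≡ 2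
  inflow-2 δ≥2 no-22 {v} dv = begin
      sumOver (adj G v) (λ u → send (deg G u) (deg G v))
    ≡⟨ sumOver-cong-on (adj G v) (λ u v~u → trans (cong (send (deg G u)) dv) (send-to-2 (3≤deg v~u))) ⟩
      card (adj G v)
    ≡⟨ trans (sym (deg≡card v)) dv ⟩
      2 ∎
    where
    open ≡-Reasoning
    3≤deg : ∀ {u} → adj G v u ≡ true → 3 ≤ deg G u
    3≤deg {u} v~u = ≤∧≢⇒< (δ≥2 u) (λ du → no-22 v u v~u dv (sym du))

  inflow-3 : ∀ {v} → deg G v ≡ 3 → inflow v ≡ degIn V≥4 v
  inflow-3 {v} dv =
    trans (sumOver-cong-on (adj G v) (λ u _ → trans (cong (send (deg G u)) dv) (send-to-3 (deg G u))))
          (sym (degIn≡sumOver-adj V≥4 v))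

  outflow-3 : ∀ {v} → deg G v ≡ 3 → outflow v + degIn (V3 G) v + degIn V≥4 v ≤ 3
  outflow-3 {v} dv = begin
      outflow v + degIn (V3 G) v + degIn V≥4 v
    ≡⟨ cong₂ (λ a b → outflow v + a + b) (degIn≡sumOver-adj (V3 G) v) (degIn≡sumOver-adj V≥4 v) ⟩
      outflow v + sumOver N (λ u → ⟦ V3 G u ⟧) + sumOver N (λ u → ⟦ V≥4 u ⟧)
    ≡⟨ sym (trans (sumOver-+ N _ (λ u → ⟦ V≥4 u ⟧))
                  (cong (_+ sumOver N (λ u → ⟦ V≥4 u ⟧)) (sumOver-+ N _ (λ u → ⟦ V3 G u ⟧)))) ⟩
      sumOver N (λ u → send (deg G v) (deg G u) + ⟦ V3 G u ⟧ + ⟦ V≥4 u ⟧)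
    ≤⟨ sumOver-mono-on N (λ u _ → at-most-one u) ⟩
      card N
    ≡⟨ trans (sym (deg≡card v)) dv ⟩
      3 ∎
    where
    open ≤-Reasoning
    N = adj G v
    at-most-one : ∀ u → send (deg G v) (deg G u) + ⟦ V3 G u ⟧ + ⟦ V≥4 u ⟧ ≤ 1
    at-most-one u rewrite dv | V3≡is3 u = send-from-3 (deg G u)

  outflow-≥4 : ∀ {v} → 4 ≤ deg G v → outflow v ≡ deg G v
  outflow-≥4 {v} d≥4 = trans (sumOver-cong-on (adj G v) (λ u _ → send-≥4 d≥4)) (sym (deg≡card v))

  -- The final charge 3 deg v − 8 − outflow v + inflow v is at least [v ∈ V₃]·(weight v − 2).
  discharge : MinDeg≥2 → NoAdjacentDeg2 → ∀ v →
              8 + (outflow v + ⟦ V3 G v ⟧ * weight v) ≤ 3 * deg G v + (inflow v + ⟦ V3 G v ⟧ * 2)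
  discharge δ≥2 no-22 v with degree-cases (δ≥2 v)
  ... | inj₁ dv rewrite outflow-2 dv | inflow-2 δ≥2 no-22 dv | V3≡is3 v | dv = ≤-refl
  ... | inj₂ (inj₁ dv) rewrite inflow-3 dv | V3≡is3 v | cong is3 dv =
    balance-3 {outflow v} {degIn (V3 G) v} dv (outflow-3 dv)
    where
    balance-3 : ∀ {o t b d} → d ≡ 3 → o + t + b ≤ 3 → 8 + (o + 1 * (t + 2 * b)) ≤ 3 * d + (b + 1 * 2)
    balance-3 {o} {t} {b} refl bound = subst₂ _≤_ (regroup o t b) (regroup′ b) (+-monoˡ-≤ (8 + b) bound)
      where
      regroup : ∀ o t b → o + t + b + (8 + b) ≡ 8 + (o + 1 * (t + 2 * b))
      regroup = solve-∀
      regroup′ : ∀ b → 3 + (8 + b) ≡ 3 * 3 + (b + 1 * 2)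
      regroup′ = solve-∀
  ... | inj₂ (inj₂ d≥4) rewrite outflow-≥4 d≥4 | V3≡is3 v | is3-≥4 d≥4 = balance-≥4 d≥4
    where
    balance-≥4 : ∀ {d i} → 4 ≤ d → 8 + (d + 0 * weight v) ≤ 3 * d + (i + 0 * 2)
    balance-≥4 {d} {i} d≥4 =
      subst₂ _≤_ (regroup d) (regroup′ d i) (+-mono-≤ (*-monoʳ-≤ 2 d≥4) (m≤m+n d (i + 0)))
      where
      regroup : ∀ d → 2 * 4 + d ≡ 8 + (d + 0)
      regroup = solve-∀
      regroup′ : ∀ d i → 2 * d + (d + (i + 0)) ≡ 3 * d + (i + 0)
      regroup′ = solve-∀

  discharging : MinDeg≥2 → NoAdjacentDeg2 → EdgeRich (V3 G) → 8 * n ≤ 3 * degSum G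
  discharging δ≥2 no-22 rich =
    subst₂ _≤_ (*-comm n 8) (cong (3 *_) (sym degSum≡sum)) (+-cancelʳ-≤ (sum outflow + W) _ _ totals)
    where
    W = sumOver (V3 G) weight
    H = sumOver (V3 G) (λ _ → 2)
    totals : n * 8 + (sum outflow + W) ≤ 3 * sum (deg G) + (sum outflow + W)
    totals = begin
        n * 8 + (sum outflow + W)
      ≡⟨ trans (cong (_+ (sum outflow + W)) (sym (sum-const n 8))) (sym (sum-+₃ (λ _ → 8) outflow _)) ⟩
        sum (λ v → 8 + (outflow v + ⟦ V3 G v ⟧ * weight v))
      ≤⟨ sum-mono-≤ (discharge δ≥2 no-22) ⟩
        sum (λ v → 3 * deg G v + (inflow v + ⟦ V3 G v ⟧ * 2))
      ≡⟨ sum-+₃ (λ v → 3 * deg G v) inflow _ ⟩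
        sum (λ v → 3 * deg G v) + (sum inflow + H)
      ≡⟨ cong₂ (λ a b → a + (b + H)) (sym (*-distribˡ-sum 3 (deg G))) (sym sum-outflow≡sum-inflow) ⟩
        3 * sum (deg G) + (sum outflow + H)
      ≤⟨ +-monoʳ-≤ (3 * sum (deg G)) (+-monoʳ-≤ (sum outflow) rich) ⟩
        3 * sum (deg G) + (sum outflow + W) ∎
      where open ≤-Reasoning

  degIn-closed : ∀ {T C x} → C ⊆ T → ClosedIn T C → C x ≡ true → degIn T x ≡ degIn C x
  degIn-closed {T} {C} {x} C⊆T C-closed Cx =
    trans (degIn≡sumOver-adj T x) (trans (sumOver-cong-on (adj G x) same) (sym (degIn≡sumOver-adj C x)))
    where
    same : ∀ u → adj G x u ≡ true → ⟦ T u ⟧ ≡ ⟦ C u ⟧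
    same u x~u with C u in Cu
    ... | true = cong ⟦_⟧ (C⊆T u Cu)
    ... | false with T u in Tu
    ...   | false = refl
    ...   | true with () ← trans (sym Cu) (C-closed x u Cx Tu x~u)

  poor-component⇒tree : MinDeg≥2 → ∀ {C} → IsComponentOf G C (V3 G) → ¬ EdgeRich C →
    IsTreeIn G C × (∀ s t → C s ≡ true → C t ≡ false → adj G s t ≡ true → deg G t ≡ 2)
  poor-component⇒tree δ≥2 {C} ((v , Cv) , C⊆V3 , C-conn , C-closed) poor =
    ((v , Cv) , C-conn , acyclic) , boundary
    where
    E = sumOver C (degIn V≥4)
    weight-total : sumOver C weight ≡ degSumIn C + 2 * E
    weight-total = trans (sumOver-+ C (degIn (V3 G)) (λ x → 2 * degIn V≥4 x))
      (cong₂ _+_ (sumOver-cong-on C (λ x Cx → degIn-closed C⊆V3 C-closed Cx)) (sumOver-* C 2 (degIn V≥4)))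
    rich-if : ∀ {k} → Excess≤ k C → k ≤ 2 * E → EdgeRich C
    rich-if excess k≤2E = subst₂ _≤_ (sym (sumOver-* C 2 (λ _ → 1))) (sym weight-total)
                                 (≤-trans excess (+-monoʳ-≤ (degSumIn C) k≤2E))
    acyclic : ¬ CycleIn G C
    acyclic cycle = poor (rich-if (connected∧cycle⇒Excess≤0 C-conn cycle) z≤n)
    no-edges-to-V≥4 : E ≡ 0
    no-edges-to-V≥4 =
      n≤0⇒n≡0 (≮⇒≥ (λ 0<E → poor (rich-if (connected⇒Excess≤2 C-conn Cv) (*-monoʳ-≤ 2 0<E))))
    boundary : ∀ s t → C s ≡ true → C t ≡ false → adj G s t ≡ true → deg G t ≡ 2
    boundary s t Cs Ct s~t with degree-cases (δ≥2 t)
    ... | inj₁ dt = dt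
    ... | inj₂ (inj₁ dt) with () ← trans (sym Ct) (C-closed s t Cs (trans (V3≡is3 t) (cong is3 dt)) s~t)
    ... | inj₂ (inj₂ d≥4) = ⊥-elim (<-irrefl refl (begin-strict
        0                   <⟨ 1≤degIn V≥4 (is≥4-≥4 d≥4) s~t ⟩
        degIn V≥4 s         ≤⟨ ≤-sumOver C (degIn V≥4) Cs ⟩
        E                   ≡⟨ no-edges-to-V≥4 ⟩
        0                   ∎))
      where open ≤-Reasoning

lemma7p11 : (n : ℕ) (G : Graph n) → MinDegreeIs G 2 → AvgDegree<8/3 G →
    (Σ (Fin n) λ u → Σ (Fin n) λ v → adj G u v ≡ true × deg G u ≡ 2 × deg G v ≡ 2)
    ⊎ (Σ (Subset G) λ S → IsComponentOf G S (V3 G) × IsTreeIn G S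
        × (∀ s t → S s ≡ true → S t ≡ false → adj G s t ≡ true → deg G t ≡ 2))
lemma7p11 n G (δ≥2 , _) avg
  with any? (λ u → any? (λ v → adj G u v Bool.≟ true ×-dec deg G u ≟ 2 ×-dec deg G v ≟ 2))
... | yes adjacent-2s = inj₁ adjacent-2s
... | no no-adjacent-2s with any? (λ v → V3 G v Bool.≟ true ×-dec ¬? (EdgeRich? G (component G (V3 G) v)))
...   | yes (v , v∈V3 , poor) = inj₂ (C , C-component , poor-component⇒tree G δ≥2 C-component poor)
  where
  C = component G (V3 G) v
  C-component = component-isComponent G (V3 G) v v∈V3
...   | no no-poor = ⊥-elim (<⇒≱ avg (discharging G δ≥2 no-22 V3-rich))
  where
  no-22 : NoAdjacentDeg2 G
  no-22 u v u~v du dv = no-adjacent-2s (u , v , u~v , du , dv)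
  V3-rich : EdgeRich G (V3 G)
  V3-rich = sumOver-≤-componentwise G (V3 G) (λ _ → 2) (weight G) λ v v∈V3 →
    decidable-stable (EdgeRich? G (component G (V3 G) v)) (λ poor → no-poor (v , v∈V3 , poor))
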